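{- Let $\mathcal{S}=\langle\mathcal{L},\vdash\rangle$ be a logical structure and $\varrho,\sigma\subseteq\mathcal{P}(\mathcal{L})\times\mathcal{L}$. Then: (i) $(\vdash^\varrho)^\sigma\,\subseteq\,\vdash^\varrho$, with equality if $\varrho\subseteq\sigma$; (ii) if $\mathcal{S}$ is monotonic, then $(\vdash^\varrho)^\sigma\,\subseteq\,\vdash^\sigma$; (iii) if $\varrho\subseteq\sigma$, then $(\vdash^\varrho)^\sigma\,\subseteq\,\vdash^\sigma$; (iv) if $\vdash^\sigma\,\subseteq\,\vdash^\varrho$, then $\vdash^\sigma\,\subseteq\,(\vdash^\varrho)^\sigma$; (v) if $\varrho\subseteq\sigma$, then $\vdash^\varrho=\vdash^\sigma$ iff $(\vdash^\varrho)^\sigma=\vdash^\sigma$. Moreover, the analogous statements (i)–(v) hold with every $\varrho$-companion replaced by the pure $\varrho$-companion and every $\sigma$-companion replaced by the pure $\sigma$-companion (i.e., with $\vdash^\varrho,\vdash^\sigma,(\vdash^\varrho)^\sigma$ replaced by $\vdash^{p\varrho},\vdash^{p\sigma},(\vdash^{p\varrho})^{p\sigma}$).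
   Context: A logical structure is a pair $\langle\mathcal{L},\vdash\rangle$ with $\mathcal{L}$ a set and $\vdash\,\subseteq\mathcal{P}(\mathcal{L})\times\mathcal{L}$ arbitrary; it is monotonic if $\Gamma\subseteq\Sigma$ and $\Gamma\vdash\alpha$ imply $\Sigma\vdash\alpha$. For $\varrho\subseteq\mathcal{P}(\mathcal{L})\times\mathcal{L}$, the $\varrho$-companion relation is: $\Gamma\vdash^\varrho\alpha$ iff there is $\Delta\subseteq\Gamma$ with $(\Delta,\alpha)\in\varrho$ and $\Delta\vdash\alpha$. The pure $\varrho$-companion relation: $\Gamma\vdash^{p\varrho}\alpha$ iff there is a nonempty $\Delta\subseteq\Gamma$ with $(\Delta,\alpha)\in\varrho$ and $\Delta\vdash\alpha$. $(\vdash^\varrho)^\sigma$ denotes the $\sigma$-companion of the logical structure $\langle\mathcal{L},\vdash^\varrho\rangle$, and $(\vdash^{p\varrho})^{p\sigma}$ the pure $\sigma$-companion of $\langle\mathcal{L},\vdash^{p\varrho}\rangle$. -}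

module Defs where

open import Data.Product using (Σ; ∃; _×_; _,_)

Subset : Set → Set₁
Subset L = L → Set

_⊆ₛ_ : {L : Set} → Subset L → Subset L → Set
Γ ⊆ₛ Σ' = ∀ x → Γ x → Σ' x

NonEmpty : {L : Set} → Subset L → Set
NonEmpty {L} Δ = ∃ λ x → Δ x

-- A relation ⊆ P(L) × L (consequence relation, or ϱ, σ); valued in Set₁
-- because companions quantify over subsets Δ.
Rel : Set → Set₂
Rel L = Subset L → L → Set₁

_⊆ᵣ_ : {L : Set} → Rel L → Rel L → Set₁
R ⊆ᵣ S = ∀ Γ α → R Γ α → S Γ α

_≐ᵣ_ : {L : Set} → Rel L → Rel L → Set₁
R ≐ᵣ S = (R ⊆ᵣ S) × (S ⊆ᵣ R)

Monotonic : {L : Set} → Rel L → Set₁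
Monotonic ⊢ = ∀ Γ Σ' α → Γ ⊆ₛ Σ' → ⊢ Γ α → ⊢ Σ' α

companion : {L : Set} → Rel L → Rel L → Rel L
companion ⊢ ϱ Γ α = Σ (Subset _) λ Δ → (Δ ⊆ₛ Γ) × ϱ Δ α × ⊢ Δ α

pureCompanion : {L : Set} → Rel L → Rel L → Rel L
pureCompanion ⊢ ϱ Γ α =
  Σ (Subset _) λ Δ → NonEmpty Δ × (Δ ⊆ₛ Γ) × ϱ Δ α × ⊢ Δ α

Items : {L : Set} → (Rel L → Rel L → Rel L) → Rel L → Rel L → Rel L → Set₁
Items C ⊢ ϱ σ =
    ((C (C ⊢ ϱ) σ ⊆ᵣ C ⊢ ϱ) × (ϱ ⊆ᵣ σ → C (C ⊢ ϱ) σ ≐ᵣ C ⊢ ϱ))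
  ×
    (Monotonic ⊢ → C (C ⊢ ϱ) σ ⊆ᵣ C ⊢ σ)
  ×
    (ϱ ⊆ᵣ σ → C (C ⊢ ϱ) σ ⊆ᵣ C ⊢ σ)
  ×
    (C ⊢ σ ⊆ᵣ C ⊢ ϱ → C ⊢ σ ⊆ᵣ C (C ⊢ ϱ) σ)
  ×
    (ϱ ⊆ᵣ σ → ((C ⊢ ϱ ≐ᵣ C ⊢ σ → C (C ⊢ ϱ) σ ≐ᵣ C ⊢ σ)
              × (C (C ⊢ ϱ) σ ≐ᵣ C ⊢ σ → C ⊢ ϱ ≐ᵣ C ⊢ σ)))

{-# OPTIONS --safe #-}
-- Both companion operators C satisfy five elementary facts: C ⊢ ϱ is always
-- monotonic, it lies below ⊢ whenever ⊢ is monotonic, C is monotone in ⊢ and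
-- in ϱ, and C ⊢ ϱ ⊆ C (C ⊢ ϱ) ϱ.  Items (i)–(v) are obtained from these facts
-- alone by chaining inclusions; in particular (C ⊢ ϱ)^σ ⊆ C ⊢ ϱ holds because
-- C ⊢ ϱ is itself monotonic.
module Submission where

open import Data.Product using (_×_; _,_; proj₁; proj₂)

open import Defs

module _ {L : Set} where

  ⊆ₛ-refl : {Δ : Subset L} → Δ ⊆ₛ Δ
  ⊆ₛ-refl x x∈Δ = x∈Δ

  ⊆ₛ-trans : {Γ Δ Θ : Subset L} → Γ ⊆ₛ Δ → Δ ⊆ₛ Θ → Γ ⊆ₛ Θ
  ⊆ₛ-trans Γ⊆Δ Δ⊆Θ x x∈Γ = Δ⊆Θ x (Γ⊆Δ x x∈Γ)

  ⊆ᵣ-trans : {R S T : Rel L} → R ⊆ᵣ S → S ⊆ᵣ T → R ⊆ᵣ T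
  ⊆ᵣ-trans R⊆S S⊆T Γ α p = S⊆T Γ α (R⊆S Γ α p)

record IsCompanionOperator {L : Set} (C : Rel L → Rel L → Rel L) : Set₂ where
  field
    monotonic        : ∀ ⊢ ϱ → Monotonic (C ⊢ ϱ)
    monotonic⇒⊆      : ∀ {⊢} ϱ → Monotonic ⊢ → C ⊢ ϱ ⊆ᵣ ⊢
    monoˡ            : ∀ {⊢ ⊢′} ϱ → ⊢ ⊆ᵣ ⊢′ → C ⊢ ϱ ⊆ᵣ C ⊢′ ϱ
    monoʳ            : ∀ ⊢ {ϱ σ} → ϱ ⊆ᵣ σ → C ⊢ ϱ ⊆ᵣ C ⊢ σ
    ⊆-selfCompanion  : ∀ ⊢ ϱ → C ⊢ ϱ ⊆ᵣ C (C ⊢ ϱ) ϱ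

  module _ (⊢ ϱ σ : Rel L) where

    companionOfCompanion-⊆ : C (C ⊢ ϱ) σ ⊆ᵣ C ⊢ ϱ
    companionOfCompanion-⊆ = monotonic⇒⊆ σ (monotonic ⊢ ϱ)

    ⊆-companionOfCompanion : ϱ ⊆ᵣ σ → C ⊢ ϱ ⊆ᵣ C (C ⊢ ϱ) σ
    ⊆-companionOfCompanion ϱ⊆σ = ⊆ᵣ-trans (⊆-selfCompanion ⊢ ϱ) (monoʳ (C ⊢ ϱ) ϱ⊆σ)

    companionOfCompanion-⊆-monotonic : Monotonic ⊢ → C (C ⊢ ϱ) σ ⊆ᵣ C ⊢ σ
    companionOfCompanion-⊆-monotonic mono = monoˡ σ (monotonic⇒⊆ ϱ mono)

    companionOfCompanion-⊆-⊆ : ϱ ⊆ᵣ σ → C (C ⊢ ϱ) σ ⊆ᵣ C ⊢ σ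
    companionOfCompanion-⊆-⊆ ϱ⊆σ = ⊆ᵣ-trans companionOfCompanion-⊆ (monoʳ ⊢ ϱ⊆σ)

    ⊆-companionOfCompanion-⊇ : C ⊢ σ ⊆ᵣ C ⊢ ϱ → C ⊢ σ ⊆ᵣ C (C ⊢ ϱ) σ
    ⊆-companionOfCompanion-⊇ σ⊆ϱ = ⊆ᵣ-trans (⊆-selfCompanion ⊢ σ) (monoˡ σ σ⊆ϱ)

    items : Items C ⊢ ϱ σ
    items =
        (companionOfCompanion-⊆ , λ ϱ⊆σ → companionOfCompanion-⊆ , ⊆-companionOfCompanion ϱ⊆σ)
      , companionOfCompanion-⊆-monotonic
      , companionOfCompanion-⊆-⊆
      , ⊆-companionOfCompanion-⊇
      , λ ϱ⊆σ →
          (λ ϱ≐σ → companionOfCompanion-⊆-⊆ ϱ⊆σ , ⊆-companionOfCompanion-⊇ (proj₂ ϱ≐σ))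
        , (λ ϱσ≐σ → ⊆ᵣ-trans (⊆-companionOfCompanion ϱ⊆σ) (proj₁ ϱσ≐σ)
                  , ⊆ᵣ-trans (proj₂ ϱσ≐σ) companionOfCompanion-⊆)

companion-isCompanionOperator : {L : Set} → IsCompanionOperator {L} companion
companion-isCompanionOperator = record
  { monotonic       = λ ⊢ ϱ Γ Σ′ α Γ⊆Σ′ (Δ , Δ⊆Γ , r , d) → Δ , ⊆ₛ-trans Δ⊆Γ Γ⊆Σ′ , r , d
  ; monotonic⇒⊆     = λ ϱ mono Γ α (Δ , Δ⊆Γ , _ , d) → mono Δ Γ α Δ⊆Γ d
  ; monoˡ           = λ ϱ ⊢⊆⊢′ Γ α (Δ , Δ⊆Γ , r , d) → Δ , Δ⊆Γ , r , ⊢⊆⊢′ Δ α d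
  ; monoʳ           = λ ⊢ ϱ⊆σ Γ α (Δ , Δ⊆Γ , r , d) → Δ , Δ⊆Γ , ϱ⊆σ Δ α r , d
  ; ⊆-selfCompanion = λ ⊢ ϱ Γ α (Δ , Δ⊆Γ , r , d) → Δ , Δ⊆Γ , r , (Δ , ⊆ₛ-refl , r , d)
  }

pureCompanion-isCompanionOperator : {L : Set} → IsCompanionOperator {L} pureCompanion
pureCompanion-isCompanionOperator = record
  { monotonic       = λ ⊢ ϱ Γ Σ′ α Γ⊆Σ′ (Δ , ne , Δ⊆Γ , r , d) → Δ , ne , ⊆ₛ-trans Δ⊆Γ Γ⊆Σ′ , r , d
  ; monotonic⇒⊆     = λ ϱ mono Γ α (Δ , _ , Δ⊆Γ , _ , d) → mono Δ Γ α Δ⊆Γ d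
  ; monoˡ           = λ ϱ ⊢⊆⊢′ Γ α (Δ , ne , Δ⊆Γ , r , d) → Δ , ne , Δ⊆Γ , r , ⊢⊆⊢′ Δ α d
  ; monoʳ           = λ ⊢ ϱ⊆σ Γ α (Δ , ne , Δ⊆Γ , r , d) → Δ , ne , Δ⊆Γ , ϱ⊆σ Δ α r , d
  ; ⊆-selfCompanion = λ ⊢ ϱ Γ α (Δ , ne , Δ⊆Γ , r , d) →
                        Δ , ne , Δ⊆Γ , r , (Δ , ne , ⊆ₛ-refl , r , d)
  }

mainTheorem7 : (L : Set) (⊢ ϱ σ : Rel L) →
    Items companion ⊢ ϱ σ × Items pureCompanion ⊢ ϱ σ
mainTheorem7 L ⊢ ϱ σ =
    IsCompanionOperator.items companion-isCompanionOperator ⊢ ϱ σ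
  , IsCompanionOperator.items pureCompanion-isCompanionOperator ⊢ ϱ σ
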